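{- Let $P$ be a finite set of propositions, $\Pi=2^P$, $\pi\in\Pi^*$ a finite trace, $i\in\mathbb{N}_{>0}$ and $\phi$ a formula of the LTL fragment described in the context. Then (1) $\mu_\pi(\phi,i)=\top$ if and only if $d_\pi(\phi,i)=(a,-)$ and there is no $x<a$ such that, for $\pi'=\pi_i\cdot\pi_{i+1}\cdots\pi_{i+x}$, $\mu_{\pi'}(\phi,1)=\top$; (2) $\mu_\pi(\phi,i)=\bot$ if and only if $d_\pi(\phi,i)=(-,a)$ and there is no $x<a$ such that, for $\pi'=\pi_i\cdot\pi_{i+1}\cdots\pi_{i+x}$, $\mu_{\pi'}(\phi,1)=\bot$; (3) $\mu_\pi(\phi,i)=\,?$ if and only if $d_\pi(\phi,i)=(b_1,b_2)$; where $a\in\mathbb{N}_0$ with $a\le|\pi|-i$, and each $b_j$ ($j\in\{1,2\}$) is either $\infty$ or an element of $\mathbb{N}_0$ with $b_j>|\pi|-i$.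
   Context: A trace $\pi=\pi_1\dots\pi_{|\pi|}$ is a finite sequence over $\Pi$. Formulas: $\phi ::= p \mid \neg\phi \mid \phi_1\vee\phi_2 \mid \mathbf{X}\phi \mid \phi_1\,\mathbf{U}\,\phi_2 \mid \mathbf{F}\phi$, $p\in P$. Three-valued semantics $\mu_\pi(\phi,i)\in\{\bot,?,\top\}$, order $\bot<?<\top$, $\neg_3$ swaps $\top,\bot$ and fixes $?$, $\vee_3=\max$, $\wedge_3=\min$: $\mu_\pi(p,i)=\top$ if $i\le|\pi|,p\in\pi_i$; $\bot$ if $i\le|\pi|,p\notin\pi_i$; $?$ if $i>|\pi|$. $\mu_\pi(\neg\phi,i)=\neg_3\mu_\pi(\phi,i)$; $\mu_\pi(\phi_1\vee\phi_2,i)=\mu_\pi(\phi_1,i)\vee_3\mu_\pi(\phi_2,i)$; $\mu_\pi(\mathbf{X}\phi,i)=\mu_\pi(\phi,i+1)$; $\mu_\pi(\mathbf{F}\phi,i)=\mu_\pi(\phi,i)\vee_3\mu_\pi(\mathbf{X}\mathbf{F}\phi,i)$ if $i\le|\pi|$, else $\mu_\pi(\phi,i)$; $\mu_\pi(\phi_1\mathbf{U}\phi_2,i)=\mu_\pi(\phi_2,i)\vee_3(\mu_\pi(\phi_1,i)\wedge_3\mu_\pi(\mathbf{X}(\phi_1\mathbf{U}\phi_2),i))$ if $i\le|\pi|$, else $\mu_\pi(\phi_2,i)$. Counting semantics: $\mathbb{N}_+=\mathbb{N}_0\cup\{\infty,-\}$ ordered $n<\infty<-$; $a\oplus b=a+b$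 if $a,b\in\mathbb{N}_0$, else $\max\{a,b\}$; $\mathrm{swap}(s,f)=(f,s)$; $(s,f)\oplus1=(s\oplus1,f\oplus1)$; $(s,f)\sqcup(s',f')=(\min(s,s'),\max(f,f'))$; $(s,f)\sqcap(s',f')=(\max(s,s'),\min(f,f'))$. $d_\pi(p,i)=(0,-)$ if $i\le|\pi|,p\in\pi_i$; $(-,0)$ if $i\le|\pi|,p\notin\pi_i$; $(0,0)$ if $i>|\pi|$. $d_\pi(\neg\phi,i)=\mathrm{swap}\,d_\pi(\phi,i)$; $d_\pi(\phi_1\vee\phi_2,i)=d_\pi(\phi_1,i)\sqcup d_\pi(\phi_2,i)$; $d_\pi(\mathbf{X}\phi,i)=d_\pi(\phi,i+1)\oplus1$; $d_\pi(\phi\mathbf{U}\psi,i)=d_\pi(\psi,i)\sqcup(d_\pi(\phi,i)\sqcap d_\pi(\mathbf{X}(\phi\mathbf{U}\psi),i))$ if $i\le|\pi|$, else $d_\pi(\psi,i)\sqcup(d_\pi(\phi,i)\sqcap(-,\infty))$; $d_\pi(\mathbf{F}\phi,i)=d_\pi(\phi,i)\sqcup d_\pi(\mathbf{X}\mathbf{F}\phi,i)$ if $i\le|\pi|$, else $d_\pi(\phi,i)\sqcup(-,\infty)$. -}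

module Defs where

open import Data.Nat using (ℕ; zero; suc; _+_; _∸_; _≤?_)
open import Data.Bool using (Bool; true; false; if_then_else_)
open import Data.Fin using (Fin)
open import Data.Fin.Subset using (Subset)
open import Data.Vec using (lookup)
open import Data.List using (List; []; _∷_; length)
open import Data.Maybe using (Maybe; just; nothing)
open import Data.Product using (_×_; _,_)
open import Relation.Nullary using (yes; no)

-- Propositions P = Fin m (a finite set), letters Π = 2^P, traces Π*

Letter : ℕ → Set
Letter m = Subset m

Trace : ℕ → Set
Trace m = List (Letter m)

-- 1-indexed access: π_i (nothing iff i > |π| or i = 0)
at : ∀ {m} → Trace m → ℕ → Maybe (Letter m)
at []       _             = nothing
at (x ∷ xs) zero          = nothing
at (x ∷ xs) (suc zero)    = just x
at (x ∷ xs) (suc (suc n)) = at xs (suc n)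

data Formula (m : ℕ) : Set where
  atom : Fin m → Formula m
  ¬'_  : Formula m → Formula m
  _∨'_ : Formula m → Formula m → Formula m
  X'   : Formula m → Formula m
  _U'_ : Formula m → Formula m → Formula m
  F'   : Formula m → Formula m

-- Three-valued semantics, order V⊥ < V? < V⊤

data V3 : Set where
  V⊥ V? V⊤ : V3

¬₃ : V3 → V3
¬₃ V⊥ = V⊤
¬₃ V? = V?
¬₃ V⊤ = V⊥

_∨₃_ : V3 → V3 → V3
V⊤ ∨₃ _  = V⊤
V? ∨₃ V⊤ = V⊤
V? ∨₃ _  = V?
V⊥ ∨₃ b  = b

_∧₃_ : V3 → V3 → V3
V⊥ ∧₃ _  = V⊥
V? ∧₃ V⊥ = V⊥
V? ∧₃ _  = V?
V⊤ ∧₃ b  = b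

-- Unfolding of U / F: the last argument k counts the remaining positions
-- |π| + 1 - i; k = suc _ corresponds to i ≤ |π|, k = 0 to i > |π|.
μ : ∀ {m} → Trace m → Formula m → ℕ → V3
μU : ∀ {m} → Trace m → Formula m → Formula m → ℕ → ℕ → V3
μF : ∀ {m} → Trace m → Formula m → ℕ → ℕ → V3

μ π (atom p) i with at π i
... | just s  = if lookup s p then V⊤ else V⊥
... | nothing = V?
μ π (¬' φ) i    = ¬₃ (μ π φ i)
μ π (φ ∨' ψ) i  = μ π φ i ∨₃ μ π ψ i
μ π (X' φ) i    = μ π φ (suc i)
μ π (φ U' ψ) i  = μU π φ ψ i (suc (length π) ∸ i)
μ π (F' φ) i    = μF π φ i (suc (length π) ∸ i)

μU π φ ψ i zero    = μ π ψ i
μU π φ ψ i (suc k) = μ π ψ i ∨₃ (μ π φ i ∧₃ μU π φ ψ (suc i) k)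

μF π φ i zero    = μ π φ i
μF π φ i (suc k) = μ π φ i ∨₃ μF π φ (suc i) k

-- Counting semantics: ℕ₊ = ℕ ∪ {∞, -} with n < ∞ < -

data ℕ₊ : Set where
  fin : ℕ → ℕ₊
  ∞   : ℕ₊
  -'  : ℕ₊

max₊ : ℕ₊ → ℕ₊ → ℕ₊
max₊ -' _ = -'
max₊ _ -' = -'
max₊ ∞ _  = ∞
max₊ _ ∞  = ∞
max₊ (fin a) (fin b) = fin (Data.Nat._⊔_ a b)

min₊ : ℕ₊ → ℕ₊ → ℕ₊
min₊ -' b = b
min₊ a -' = a
min₊ ∞ b  = b
min₊ a ∞  = a
min₊ (fin a) (fin b) = fin (Data.Nat._⊓_ a b)

_⊕_ : ℕ₊ → ℕ₊ → ℕ₊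
fin a ⊕ fin b = fin (a + b)
a     ⊕ b     = max₊ a b

Pair : Set
Pair = ℕ₊ × ℕ₊

swap₊ : Pair → Pair
swap₊ (s , f) = (f , s)

_⊕1 : Pair → Pair
(s , f) ⊕1 = (s ⊕ fin 1 , f ⊕ fin 1)

_⊔ₚ_ : Pair → Pair → Pair
(s , f) ⊔ₚ (s' , f') = (min₊ s s' , max₊ f f')

_⊓ₚ_ : Pair → Pair → Pair
(s , f) ⊓ₚ (s' , f') = (max₊ s s' , min₊ f f')

d : ∀ {m} → Trace m → Formula m → ℕ → Pair
dU : ∀ {m} → Trace m → Formula m → Formula m → ℕ → ℕ → Pair
dF : ∀ {m} → Trace m → Formula m → ℕ → ℕ → Pair

d π (atom p) i with at π i
... | just s  = if lookup s p then (fin 0 , -') else (-' , fin 0)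
... | nothing = (fin 0 , fin 0)
d π (¬' φ) i    = swap₊ (d π φ i)
d π (φ ∨' ψ) i  = d π φ i ⊔ₚ d π ψ i
d π (X' φ) i    = (d π φ (suc i)) ⊕1
d π (φ U' ψ) i  = dU π φ ψ i (suc (length π) ∸ i)
d π (F' φ) i    = dF π φ i (suc (length π) ∸ i)

-- dU π φ ψ i (|π|+1-i) = d_π(φ U ψ, i);  d_π(X(φ U ψ), i) = d_π(φ U ψ, i+1) ⊕ 1
dU π φ ψ i zero    = d π ψ i ⊔ₚ (d π φ i ⊓ₚ (-' , ∞))
dU π φ ψ i (suc k) = d π ψ i ⊔ₚ (d π φ i ⊓ₚ (dU π φ ψ (suc i) k ⊕1))

dF π φ i zero    = d π φ i ⊔ₚ (-' , ∞)
dF π φ i (suc k) = d π φ i ⊔ₚ (dF π φ (suc i) k ⊕1)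

infix-slice : ∀ {m} → Trace m → ℕ → ℕ → Trace m
infix-slice π i x = Data.List.take (suc x) (Data.List.drop (i ∸ 1) π)

-- Both semantics unfold φ along the same recursion, so one proves, by induction on φ and
-- (for U and F) on the number of positions left in π, an invariant linking them at every
-- position i ≥ 1.  A verdict ⊤ (resp. ⊥) comes with a pair (a , -) (resp. (- , a)) whose
-- count a stays inside the trace, and ? with two counts that are ∞ or point past its end.
-- Moreover the counts are minimal: evaluated at i on the prefix of π of length i + x, φ is
-- not ⊤ for x below the first count and not ⊥ for x below the second.  The binary
-- operations and X act on verdicts and counts compatibly (the counts being shifted by one
-- under X), and evaluating on that prefix at i is evaluating on π_i ⋯ π_{i+x} at 1.
module Submission where

open import Defs
open import Data.Nat using (ℕ; _+_; _≤_; _<_)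
open import Data.List using (length)
open import Data.Product using (_×_; _,_; ∃-syntax)
open import Data.Sum using (_⊎_)
open import Relation.Binary.PropositionalEquality using (_≡_; _≢_)
open import Function.Bundles using (_⇔_)

open import Data.Nat using (zero; suc; _∸_; _⊓_; _⊔_; z≤n; s≤s)
open import Data.Nat.Properties
open import Data.List using ([]; _∷_; take; drop)
open import Data.List.Properties using (length-take; take-drop)
open import Data.Product using (proj₁; proj₂)
open import Data.Sum using (inj₁; inj₂)
open import Data.Unit using (⊤; tt)
open import Data.Maybe using (just; nothing)
open import Data.Bool using (true; false)
open import Data.Vec using (lookup)
open import Data.Empty using (⊥-elim)
open import Relation.Binary.PropositionalEquality
  using (refl; sym; trans; cong; subst; module ≡-Reasoning)
open import Function.Bundles using (mk⇔; Equivalence)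

private variable
  m n i a k : ℕ
  s f : ℕ₊
  u v : V3
  p q : Pair

∨₃-≡⊤ : ∀ u v → u ∨₃ v ≡ V⊤ → u ≡ V⊤ ⊎ v ≡ V⊤
∨₃-≡⊤ V⊤ _  _ = inj₁ refl
∨₃-≡⊤ V? V⊤ _ = inj₂ refl
∨₃-≡⊤ V⊥ V⊤ _ = inj₂ refl
∨₃-≡⊤ V? V? ()
∨₃-≡⊤ V? V⊥ ()
∨₃-≡⊤ V⊥ V? ()
∨₃-≡⊤ V⊥ V⊥ ()

∨₃-≡⊥ : ∀ u v → u ∨₃ v ≡ V⊥ → u ≡ V⊥ × v ≡ V⊥
∨₃-≡⊥ V⊥ V⊥ _ = refl , refl
∨₃-≡⊥ V⊥ V? ()
∨₃-≡⊥ V⊥ V⊤ ()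
∨₃-≡⊥ V? V⊥ ()
∨₃-≡⊥ V? V? ()
∨₃-≡⊥ V? V⊤ ()
∨₃-≡⊥ V⊤ _  ()

¬₃-≡⊤ : ∀ v → ¬₃ v ≡ V⊤ → v ≡ V⊥
¬₃-≡⊤ V⊥ _ = refl

¬₃-≡⊥ : ∀ v → ¬₃ v ≡ V⊥ → v ≡ V⊤
¬₃-≡⊥ V⊤ _ = refl

∧₃-deMorgan : ∀ u v → ¬₃ (¬₃ u ∨₃ ¬₃ v) ≡ u ∧₃ v
∧₃-deMorgan V⊥ _  = refl
∧₃-deMorgan V? V⊥ = refl
∧₃-deMorgan V? V? = refl
∧₃-deMorgan V? V⊤ = refl
∧₃-deMorgan V⊤ V⊥ = refl
∧₃-deMorgan V⊤ V? = refl
∧₃-deMorgan V⊤ V⊤ = refl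

data PastEnd (n i : ℕ) : ℕ₊ → Set where
  ∞-past   : PastEnd n i ∞
  fin-past : ∀ k → n < k + i → PastEnd n i (fin k)

pastEnd⇔ : PastEnd n i s ⇔ (s ≡ ∞ ⊎ ∃[ k ] (s ≡ fin k × n < k + i))
pastEnd⇔ = mk⇔ to from
  where
  to : PastEnd n i s → s ≡ ∞ ⊎ ∃[ k ] (s ≡ fin k × n < k + i)
  to ∞-past         = inj₁ refl
  to (fin-past k h) = inj₂ (k , refl , h)
  from : s ≡ ∞ ⊎ ∃[ k ] (s ≡ fin k × n < k + i) → PastEnd n i s
  from (inj₁ refl)           = ∞-past
  from (inj₂ (k , refl , h)) = fin-past k h

within≤past : a + i ≤ n → n < k + i → a ≤ k
within≤past {a} {i} {k = k} a+i≤n n<k+i = <⇒≤ (+-cancelʳ-< i a k (≤-<-trans a+i≤n n<k+i))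

min₊-identityʳ : ∀ s → min₊ s -' ≡ s
min₊-identityʳ (fin _) = refl
min₊-identityʳ ∞       = refl
min₊-identityʳ -'      = refl

max₊-zeroʳ : ∀ s → max₊ s -' ≡ -'
max₊-zeroʳ (fin _) = refl
max₊-zeroʳ ∞       = refl
max₊-zeroʳ -'      = refl

min₊-∞ʳ : PastEnd n i s → min₊ s ∞ ≡ s
min₊-∞ʳ ∞-past         = refl
min₊-∞ʳ (fin-past _ _) = refl

max₊-∞ʳ : PastEnd n i s → max₊ s ∞ ≡ ∞
max₊-∞ʳ ∞-past         = refl
max₊-∞ʳ (fin-past _ _) = refl

min₊-within-past : a + i ≤ n → PastEnd n i s → min₊ (fin a) s ≡ fin a
min₊-within-past h ∞-past         = refl
min₊-within-past h (fin-past k h′) = cong fin (m≤n⇒m⊓n≡m (within≤past h h′))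

min₊-past-within : a + i ≤ n → PastEnd n i s → min₊ s (fin a) ≡ fin a
min₊-past-within h ∞-past         = refl
min₊-past-within h (fin-past k h′) = cong fin (m≥n⇒m⊓n≡n (within≤past h h′))

max₊-within-past : a + i ≤ n → PastEnd n i s → max₊ (fin a) s ≡ s
max₊-within-past h ∞-past         = refl
max₊-within-past h (fin-past k h′) = cong fin (m≤n⇒m⊔n≡n (within≤past h h′))

max₊-past-within : a + i ≤ n → PastEnd n i s → max₊ s (fin a) ≡ s
max₊-past-within h ∞-past         = refl
max₊-past-within h (fin-past k h′) = cong fin (m≥n⇒m⊔n≡m (within≤past h h′))

pastEnd-min : PastEnd n i s → PastEnd n i f → PastEnd n i (min₊ s f)
pastEnd-min ∞-past         ∞-past          = ∞-past
pastEnd-min ∞-past         (fin-past k h)  = fin-past k h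
pastEnd-min (fin-past k h) ∞-past          = fin-past k h
pastEnd-min {n} {i} (fin-past k h) (fin-past l h′) =
  fin-past (k ⊓ l) (subst (n <_) (sym (+-distribʳ-⊓ i k l)) (⊓-glb h h′))

pastEnd-max : PastEnd n i s → PastEnd n i f → PastEnd n i (max₊ s f)
pastEnd-max ∞-past         ∞-past          = ∞-past
pastEnd-max ∞-past         (fin-past _ _)  = ∞-past
pastEnd-max (fin-past k h) ∞-past          = ∞-past
pastEnd-max {i = i} (fin-past k h) (fin-past l _) =
  fin-past (k ⊔ l) (<-≤-trans h (+-monoˡ-≤ i (m≤m⊔n k l)))

pastEnd-⊕1 : PastEnd n (suc i) s → PastEnd n i (s ⊕ fin 1)
pastEnd-⊕1 ∞-past = ∞-past
pastEnd-⊕1 {n} (fin-past k h) = fin-past (k + 1) (subst (n <_) (sym (+-assoc k 1 _)) h)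

-- Parts (1)-(3) of the theorem without the minimality clauses, for a trace of length n.

data Agree (n i : ℕ) : V3 → Pair → Set where
  agree-⊤ : ∀ a → a + i ≤ n → Agree n i V⊤ (fin a , -')
  agree-⊥ : ∀ a → a + i ≤ n → Agree n i V⊥ (-' , fin a)
  agree-? : PastEnd n i s → PastEnd n i f → Agree n i V? (s , f)

agree-¬ : Agree n i v p → Agree n i (¬₃ v) (swap₊ p)
agree-¬ (agree-⊤ a h)   = agree-⊥ a h
agree-¬ (agree-⊥ a h)   = agree-⊤ a h
agree-¬ (agree-? ps pf) = agree-? pf ps

agree-∨ : Agree n i u p → Agree n i v q → Agree n i (u ∨₃ v) (p ⊔ₚ q)
agree-∨ {i = i} (agree-⊤ a h) (agree-⊤ b h′) =
  agree-⊤ (a ⊓ b) (≤-trans (+-monoˡ-≤ i (m⊓n≤m a b)) h)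
agree-∨ (agree-⊤ a h) (agree-⊥ _ _) = agree-⊤ a h
agree-∨ (agree-⊤ a h) (agree-? ps _) rewrite min₊-within-past {a} h ps = agree-⊤ a h
agree-∨ (agree-⊥ _ _) (agree-⊤ b h′) = agree-⊤ b h′
agree-∨ {i = i} (agree-⊥ a h) (agree-⊥ b h′) =
  agree-⊥ (a ⊔ b) (subst (_≤ _) (sym (+-distribʳ-⊔ i a b)) (⊔-lub h h′))
agree-∨ (agree-⊥ a h) (agree-? ps pf) rewrite max₊-within-past {a} h pf = agree-? ps pf
agree-∨ (agree-? {s} {f} ps _) (agree-⊤ b h′)
  rewrite min₊-past-within {b} h′ ps | max₊-zeroʳ f = agree-⊤ b h′
agree-∨ (agree-? {s} ps pf) (agree-⊥ b h′)
  rewrite min₊-identityʳ s | max₊-past-within {b} h′ pf = agree-? ps pf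
agree-∨ (agree-? ps pf) (agree-? ps′ pf′) = agree-? (pastEnd-min ps ps′) (pastEnd-max pf pf′)

agree-∧ : Agree n i u p → Agree n i v q → Agree n i (u ∧₃ v) (p ⊓ₚ q)
agree-∧ {n} {i} {u} {p} {v} {q} Au Av =
  subst (λ w → Agree n i w (p ⊓ₚ q)) (∧₃-deMorgan u v)
    (agree-¬ (agree-∨ (agree-¬ Au) (agree-¬ Av)))

agree-X : Agree n (suc i) v p → Agree n i v (p ⊕1)
agree-X {n} (agree-⊤ a h)   = agree-⊤ (a + 1) (subst (_≤ n) (sym (+-assoc a 1 _)) h)
agree-X {n} (agree-⊥ a h)   = agree-⊥ (a + 1) (subst (_≤ n) (sym (+-assoc a 1 _)) h)
agree-X     (agree-? ps pf) = agree-? (pastEnd-⊕1 ps) (pastEnd-⊕1 pf)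

within⇒≤ : a + i ≤ n → i ≤ n
within⇒≤ {a} h = ≤-trans (m≤n+m _ a) h

agree-U-past-end : n < i → Agree n i u p → Agree n i v q →
                   Agree n i v (q ⊔ₚ (p ⊓ₚ (-' , ∞)))
agree-U-past-end n<i (agree-⊤ a h) _ = ⊥-elim (<⇒≱ n<i (within⇒≤ h))
agree-U-past-end n<i (agree-⊥ a h) _ = ⊥-elim (<⇒≱ n<i (within⇒≤ h))
agree-U-past-end n<i (agree-? _ _) (agree-⊤ a h) = ⊥-elim (<⇒≱ n<i (within⇒≤ h))
agree-U-past-end n<i (agree-? _ _) (agree-⊥ a h) = ⊥-elim (<⇒≱ n<i (within⇒≤ h))
agree-U-past-end n<i (agree-? {s} _ pf) (agree-? {s′} ps′ pf′)
  rewrite max₊-zeroʳ s | min₊-identityʳ s′ | min₊-∞ʳ pf = agree-? ps′ (pastEnd-max pf′ pf)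

agree-F-past-end : n < i → Agree n i v p → Agree n i v (p ⊔ₚ (-' , ∞))
agree-F-past-end n<i (agree-⊤ a h) = ⊥-elim (<⇒≱ n<i (within⇒≤ h))
agree-F-past-end n<i (agree-⊥ a h) = ⊥-elim (<⇒≱ n<i (within⇒≤ h))
agree-F-past-end n<i (agree-? {s} ps pf)
  rewrite min₊-identityʳ s | max₊-∞ʳ pf = agree-? ps ∞-past

agree-fin-⊤ : Agree n i v (fin a , -') → v ≡ V⊤
agree-fin-⊤ (agree-⊤ _ _) = refl
agree-fin-⊤ (agree-? _ ())

agree-fin-⊥ : Agree n i v (-' , fin a) → v ≡ V⊥
agree-fin-⊥ (agree-⊥ _ _) = refl
agree-fin-⊥ (agree-? () _)

agree-past-end-? : Agree n i v (s , f) → PastEnd n i s → PastEnd n i f → v ≡ V?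
agree-past-end-? (agree-⊤ _ _) _ ()
agree-past-end-? (agree-⊥ _ _) () _
agree-past-end-? (agree-? _ _) _ _ = refl

_<₊_ : ℕ → ℕ₊ → Set
x <₊ fin a = x < a
x <₊ ∞     = ⊤
x <₊ -'    = ⊤

Minimal : (ℕ → V3) → Pair → Set
Minimal P (s , f) = (∀ x → x <₊ s → P x ≢ V⊤) × (∀ x → x <₊ f → P x ≢ V⊥)

<₊-min : ∀ {x} s f → x <₊ min₊ s f → x <₊ s × x <₊ f
<₊-min (fin a) (fin b) lt = m<n⊓o⇒m<n a b lt , m<n⊓o⇒m<o a b lt
<₊-min (fin a) ∞       lt = lt , tt
<₊-min (fin a) -'      lt = lt , tt
<₊-min ∞       (fin b) lt = tt , lt
<₊-min ∞       ∞       lt = tt , lt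
<₊-min ∞       -'      lt = tt , lt
<₊-min -'      _       lt = tt , lt

<₊-max : ∀ {x} s f → x <₊ max₊ s f → x <₊ s ⊎ x <₊ f
<₊-max (fin a) (fin b) lt with ⊔-sel a b
... | inj₁ a⊔b≡a = inj₁ (subst (_ <_) a⊔b≡a lt)
... | inj₂ a⊔b≡b = inj₂ (subst (_ <_) a⊔b≡b lt)
<₊-max (fin a) ∞       _ = inj₂ tt
<₊-max (fin a) -'      _ = inj₂ tt
<₊-max ∞       _       _ = inj₁ tt
<₊-max -'      _       _ = inj₁ tt

<₊-⊕1 : ∀ {x} s → suc x <₊ (s ⊕ fin 1) → x <₊ s
<₊-⊕1 {x} (fin a) lt = ≤-pred (subst (suc x <_) (+-comm a 1) lt)
<₊-⊕1 ∞       _  = tt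
<₊-⊕1 -'      _  = tt

minimal-cong : ∀ {P Q} → (∀ x → P x ≡ Q x) → Minimal Q p → Minimal P p
minimal-cong P≗Q (t , b) =
  (λ x lt e → t x lt (trans (sym (P≗Q x)) e)) , (λ x lt e → b x lt (trans (sym (P≗Q x)) e))

minimal-¬ : ∀ {P} → Minimal P p → Minimal (λ x → ¬₃ (P x)) (swap₊ p)
minimal-¬ {P = P} (t , b) =
  (λ x lt e → b x lt (¬₃-≡⊤ (P x) e)) , (λ x lt e → t x lt (¬₃-≡⊥ (P x) e))

minimal-∨ : ∀ {P Q} → Minimal P p → Minimal Q q → Minimal (λ x → P x ∨₃ Q x) (p ⊔ₚ q)
minimal-∨ {s , f} {s′ , f′} {P} {Q} (t , b) (t′ , b′) = noTop , noBot
  where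
  noTop : ∀ x → x <₊ min₊ s s′ → P x ∨₃ Q x ≢ V⊤
  noTop x lt e with <₊-min s s′ lt | ∨₃-≡⊤ (P x) (Q x) e
  ... | lt₁ , _ | inj₁ e₁ = t x lt₁ e₁
  ... | _ , lt₂ | inj₂ e₂ = t′ x lt₂ e₂
  noBot : ∀ x → x <₊ max₊ f f′ → P x ∨₃ Q x ≢ V⊥
  noBot x lt e with <₊-max f f′ lt | ∨₃-≡⊥ (P x) (Q x) e
  ... | inj₁ lt₁ | e₁ , _ = b x lt₁ e₁
  ... | inj₂ lt₂ | _ , e₂ = b′ x lt₂ e₂

minimal-∧ : ∀ {P Q} → Minimal P p → Minimal Q q → Minimal (λ x → P x ∧₃ Q x) (p ⊓ₚ q)
minimal-∧ {P = P} {Q} MP MQ =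
  minimal-cong (λ x → sym (∧₃-deMorgan (P x) (Q x)))
    (minimal-¬ (minimal-∨ (minimal-¬ MP) (minimal-¬ MQ)))

minimal-next : ∀ {P} → Minimal (λ x → P (suc x)) p → P 0 ≡ V? → Minimal P (p ⊕1)
minimal-next {s , f} {P} (t , b) P0≡? = noTop , noBot
  where
  noTop : ∀ x → x <₊ (s ⊕ fin 1) → P x ≢ V⊤
  noTop zero    _  e with trans (sym P0≡?) e
  ... | ()
  noTop (suc x) lt e = t x (<₊-⊕1 s lt) e
  noBot : ∀ x → x <₊ (f ⊕ fin 1) → P x ≢ V⊥
  noBot zero    _  e with trans (sym P0≡?) e
  ... | ()
  noBot (suc x) lt e = b x (<₊-⊕1 f lt) e

minimal-undecided : ∀ {P} → (∀ x → P x ≡ V?) → Minimal P p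
minimal-undecided P≡? = minimal-cong P≡? ((λ _ _ ()) , (λ _ _ ()))

Verdict⊤ Verdict⊥ : (n i : ℕ) → Pair → (ℕ → V3) → Set
Verdict⊤ n i p P = ∃[ a ] (a + i ≤ n × p ≡ (fin a , -') × (∀ x → x < a → P x ≢ V⊤))
Verdict⊥ n i p P = ∃[ a ] (a + i ≤ n × p ≡ (-' , fin a) × (∀ x → x < a → P x ≢ V⊥))

Verdict? : (n i : ℕ) → Pair → Set
Verdict? n i p = ∃[ s ] ∃[ f ] (p ≡ (s , f)
                                × (s ≡ ∞ ⊎ ∃[ k ] (s ≡ fin k × n < k + i))
                                × (f ≡ ∞ ⊎ ∃[ k ] (f ≡ fin k × n < k + i)))

agree-⊤⇔ : ∀ {P} → Agree n i v p → Minimal P p → v ≡ V⊤ ⇔ Verdict⊤ n i p P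
agree-⊤⇔ {n} {i} {v} {p} {P} A M =
  mk⇔ (to A M) (λ (_ , _ , e , _) → agree-fin-⊤ (subst (Agree n i v) e A))
  where
  to : ∀ {p} → Agree n i v p → Minimal P p → v ≡ V⊤ → Verdict⊤ n i p P
  to (agree-⊤ a h) (t , _) refl = a , h , refl , t

agree-⊥⇔ : ∀ {P} → Agree n i v p → Minimal P p → v ≡ V⊥ ⇔ Verdict⊥ n i p P
agree-⊥⇔ {n} {i} {v} {p} {P} A M =
  mk⇔ (to A M) (λ (_ , _ , e , _) → agree-fin-⊥ (subst (Agree n i v) e A))
  where
  to : ∀ {p} → Agree n i v p → Minimal P p → v ≡ V⊥ → Verdict⊥ n i p P
  to (agree-⊥ a h) (_ , b) refl = a , h , refl , b

agree-?⇔ : Agree n i v p → v ≡ V? ⇔ Verdict? n i p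
agree-?⇔ {n} {i} {v} {p} A = mk⇔ (to A) from
  where
  to : ∀ {p} → Agree n i v p → v ≡ V? → Verdict? n i p
  to (agree-? ps pf) refl = _ , _ , refl , Equivalence.to pastEnd⇔ ps , Equivalence.to pastEnd⇔ pf
  from : Verdict? n i p → v ≡ V?
  from (_ , _ , e , ps , pf) = agree-past-end-? (subst (Agree n i v) e A)
    (Equivalence.from pastEnd⇔ ps) (Equivalence.from pastEnd⇔ pf)

∸≡suc⇒ : ∀ n i → suc n ∸ i ≡ suc k → i ≤ n × n ∸ i ≡ k
∸≡suc⇒ n i e = i≤n , suc-injective (trans (sym (+-∸-assoc 1 i≤n)) e)
  where
  i≤n : i ≤ n
  i≤n = ≤-pred (m∸n≢0⇒n<m (λ e₀ → 1+n≢0 (trans (sym e) e₀)))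

length-take-≤ˡ : ∀ k (ρ : Trace m) → length (take k ρ) ≤ k
length-take-≤ˡ k ρ = subst (_≤ k) (sym (length-take k ρ)) (m⊓n≤m k _)

length-take-≤ʳ : ∀ k (ρ : Trace m) → length (take k ρ) ≤ length ρ
length-take-≤ʳ k ρ = subst (_≤ length ρ) (sym (length-take k ρ)) (m⊓n≤n k _)

≤-length-take : ∀ k (ρ : Trace m) → i ≤ k → i ≤ length ρ → i ≤ length (take k ρ)
≤-length-take k ρ i≤k i≤ρ = subst (_ ≤_) (sym (length-take k ρ)) (⊓-glb i≤k i≤ρ)

at-take : ∀ (ρ : Trace m) k i → i ≤ k → at (take k ρ) i ≡ at ρ i
at-take []      zero    i             _         = refl
at-take []      (suc k) i             _         = refl
at-take (x ∷ ρ) zero    zero          _         = refl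
at-take (x ∷ ρ) (suc k) zero          _         = refl
at-take (x ∷ ρ) (suc k) (suc zero)    _         = refl
at-take (x ∷ ρ) (suc k) (suc (suc i)) (s≤s i≤k) = at-take ρ k (suc i) i≤k

at-past-end : ∀ (ρ : Trace m) i → length ρ < i → at ρ i ≡ nothing
at-past-end []      i             _               = refl
at-past-end (x ∷ ρ) (suc (suc i)) (s≤s ρ<1+i) = at-past-end ρ (suc i) ρ<1+i

at-just⇒≤ : ∀ (ρ : Trace m) i {σ} → at ρ i ≡ just σ → i ≤ length ρ
at-just⇒≤ (x ∷ ρ) (suc zero)    _ = s≤s z≤n
at-just⇒≤ (x ∷ ρ) (suc (suc i)) e = s≤s (at-just⇒≤ ρ (suc i) e)

at-nothing⇒> : ∀ (ρ : Trace m) i → 1 ≤ i → at ρ i ≡ nothing → length ρ < i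
at-nothing⇒> []      i             1≤i _ = 1≤i
at-nothing⇒> (x ∷ ρ) (suc (suc i)) _   e = s≤s (at-nothing⇒> ρ (suc i) (s≤s z≤n) e)

μ-past-end : ∀ (ρ : Trace m) φ i → length ρ < i → μ ρ φ i ≡ V?
μ-past-end ρ (atom p) i h rewrite at-past-end ρ i h = refl
μ-past-end ρ (¬' φ)   i h rewrite μ-past-end ρ φ i h = refl
μ-past-end ρ (φ ∨' ψ) i h rewrite μ-past-end ρ φ i h | μ-past-end ρ ψ i h = refl
μ-past-end ρ (X' φ)   i h = μ-past-end ρ φ (suc i) (m≤n⇒m≤1+n h)
μ-past-end ρ (φ U' ψ) i h rewrite m≤n⇒m∸n≡0 h = μ-past-end ρ ψ i h
μ-past-end ρ (F' φ)   i h rewrite m≤n⇒m∸n≡0 h = μ-past-end ρ φ i h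

μ-U-unfold : ∀ (ρ : Trace m) φ ψ i → i ≤ length ρ →
  μ ρ (φ U' ψ) i ≡ μ ρ ψ i ∨₃ (μ ρ φ i ∧₃ μ ρ (φ U' ψ) (suc i))
μ-U-unfold ρ φ ψ i i≤ρ rewrite +-∸-assoc 1 i≤ρ = refl

μ-F-unfold : ∀ (ρ : Trace m) φ i → i ≤ length ρ → μ ρ (F' φ) i ≡ μ ρ φ i ∨₃ μ ρ (F' φ) (suc i)
μ-F-unfold ρ φ i i≤ρ rewrite +-∸-assoc 1 i≤ρ = refl

μ-atom-take : ∀ (ρ : Trace m) p k i → i ≤ k → μ (take k ρ) (atom p) i ≡ μ ρ (atom p) i
μ-atom-take ρ p k i i≤k rewrite at-take ρ k i i≤k = refl

module _ {m} (π : Trace m) where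

  μ-prefix : Formula m → ℕ → ℕ → V3
  μ-prefix φ i x = μ (take (i + x) π) φ i

  Describes : Formula m → ℕ → V3 → Pair → Set
  Describes φ i v p = Agree (length π) i v p × Minimal (μ-prefix φ i) p

  DescribedFrom1 : Formula m → Set
  DescribedFrom1 φ = ∀ j → 1 ≤ j → Describes φ j (μ π φ j) (d π φ j)

  prefix-past-end : length π < i → ∀ x → length (take (i + x) π) < i
  prefix-past-end {i} π<i x = ≤-<-trans (length-take-≤ʳ (i + x) π) π<i

  agree-atom : ∀ p i → 1 ≤ i → Agree (length π) i (μ π (atom p) i) (d π (atom p) i)
  agree-atom p i 1≤i with at π i in eq
  ... | nothing = agree-? (fin-past 0 π<i) (fin-past 0 π<i)
    where
    π<i : length π < i
    π<i = at-nothing⇒> π i 1≤i eq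
  ... | just σ with lookup σ p
  ...   | true  = agree-⊤ 0 (at-just⇒≤ π i eq)
  ...   | false = agree-⊥ 0 (at-just⇒≤ π i eq)

  minimal-atom : ∀ p i → Minimal (λ _ → μ π (atom p) i) (d π (atom p) i)
  minimal-atom p i with at π i
  ... | nothing = (λ _ ()) , (λ _ ())
  ... | just σ with lookup σ p
  ...   | true  = (λ _ ()) , (λ _ _ ())
  ...   | false = (λ _ _ ()) , (λ _ ())

  minimal-X : ∀ φ i → Minimal (μ-prefix φ (suc i)) p → Minimal (μ-prefix (X' φ) i) (p ⊕1)
  minimal-X φ i M = minimal-next (minimal-cong shift M) at-offset-0
    where
    shift : ∀ x → μ-prefix (X' φ) i (suc x) ≡ μ-prefix φ (suc i) x
    shift x = cong (λ t → μ (take t π) φ (suc i)) (+-suc i x)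
    at-offset-0 : μ-prefix (X' φ) i 0 ≡ V?
    at-offset-0 = μ-past-end (take (i + 0) π) φ (suc i)
      (s≤s (subst (length (take (i + 0) π) ≤_) (+-identityʳ i) (length-take-≤ˡ (i + 0) π)))

  describes-U : ∀ {φ ψ} → DescribedFrom1 φ → DescribedFrom1 ψ →
    ∀ k i → 1 ≤ i → suc (length π) ∸ i ≡ k →
    Describes (φ U' ψ) i (μU π φ ψ i k) (dU π φ ψ i k)
  describes-U {φ} {ψ} Dφ Dψ zero i 1≤i e =
    agree-U-past-end π<i (proj₁ (Dφ i 1≤i)) (proj₁ (Dψ i 1≤i)) ,
    minimal-undecided (λ x → μ-past-end (take (i + x) π) (φ U' ψ) i (prefix-past-end π<i x))
    where
    π<i : length π < i
    π<i = m∸n≡0⇒m≤n e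
  describes-U {φ} {ψ} Dφ Dψ (suc k) i 1≤i e =
    let Aφ , Mφ       = Dφ i 1≤i
        Aψ , Mψ       = Dψ i 1≤i
        Anext , Mnext = describes-U Dφ Dψ k (suc i) (s≤s z≤n) (proj₂ (∸≡suc⇒ (length π) i e))
    in agree-∨ Aψ (agree-∧ Aφ (agree-X Anext)) ,
       minimal-cong unfold (minimal-∨ Mψ (minimal-∧ Mφ (minimal-X (φ U' ψ) i Mnext)))
    where
    i≤π : i ≤ length π
    i≤π = proj₁ (∸≡suc⇒ (length π) i e)
    unfold : ∀ x → μ-prefix (φ U' ψ) i x
                 ≡ μ-prefix ψ i x ∨₃ (μ-prefix φ i x ∧₃ μ-prefix (X' (φ U' ψ)) i x)
    unfold x = μ-U-unfold (take (i + x) π) φ ψ i (≤-length-take (i + x) π (m≤m+n i x) i≤π)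

  describes-F : ∀ {φ} → DescribedFrom1 φ →
    ∀ k i → 1 ≤ i → suc (length π) ∸ i ≡ k →
    Describes (F' φ) i (μF π φ i k) (dF π φ i k)
  describes-F {φ} Dφ zero i 1≤i e =
    agree-F-past-end π<i (proj₁ (Dφ i 1≤i)) ,
    minimal-undecided (λ x → μ-past-end (take (i + x) π) (F' φ) i (prefix-past-end π<i x))
    where
    π<i : length π < i
    π<i = m∸n≡0⇒m≤n e
  describes-F {φ} Dφ (suc k) i 1≤i e =
    let Aφ , Mφ       = Dφ i 1≤i
        Anext , Mnext = describes-F Dφ k (suc i) (s≤s z≤n) (proj₂ (∸≡suc⇒ (length π) i e))
    in agree-∨ Aφ (agree-X Anext) ,
       minimal-cong unfold (minimal-∨ Mφ (minimal-X (F' φ) i Mnext))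
    where
    i≤π : i ≤ length π
    i≤π = proj₁ (∸≡suc⇒ (length π) i e)
    unfold : ∀ x → μ-prefix (F' φ) i x ≡ μ-prefix φ i x ∨₃ μ-prefix (X' (F' φ)) i x
    unfold x = μ-F-unfold (take (i + x) π) φ i (≤-length-take (i + x) π (m≤m+n i x) i≤π)

  describes : ∀ φ → DescribedFrom1 φ
  describes (atom p) i 1≤i =
    agree-atom p i 1≤i ,
    minimal-cong (λ x → μ-atom-take π p (i + x) i (m≤m+n i x)) (minimal-atom p i)
  describes (¬' φ) i 1≤i =
    let A , M = describes φ i 1≤i in agree-¬ A , minimal-¬ M
  describes (φ ∨' ψ) i 1≤i =
    let Aφ , Mφ = describes φ i 1≤i
        Aψ , Mψ = describes ψ i 1≤i
    in agree-∨ Aφ Aψ , minimal-∨ Mφ Mψ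
  describes (X' φ) i 1≤i =
    let A , M = describes φ (suc i) (s≤s z≤n) in agree-X A , minimal-X φ i M
  describes (φ U' ψ) i 1≤i = describes-U (describes φ) (describes ψ) _ i 1≤i refl
  describes (F' φ) i 1≤i = describes-F (describes φ) _ i 1≤i refl

μU-∷ : ∀ y (ρ : Trace m) φ ψ →
  (∀ j → μ (y ∷ ρ) φ (suc (suc j)) ≡ μ ρ φ (suc j)) →
  (∀ j → μ (y ∷ ρ) ψ (suc (suc j)) ≡ μ ρ ψ (suc j)) →
  ∀ k j → μU (y ∷ ρ) φ ψ (suc (suc j)) k ≡ μU ρ φ ψ (suc j) k
μU-∷ y ρ φ ψ φ-∷ ψ-∷ zero    j = ψ-∷ j
μU-∷ y ρ φ ψ φ-∷ ψ-∷ (suc k) j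
  rewrite φ-∷ j | ψ-∷ j | μU-∷ y ρ φ ψ φ-∷ ψ-∷ k (suc j) = refl

μF-∷ : ∀ y (ρ : Trace m) φ →
  (∀ j → μ (y ∷ ρ) φ (suc (suc j)) ≡ μ ρ φ (suc j)) →
  ∀ k j → μF (y ∷ ρ) φ (suc (suc j)) k ≡ μF ρ φ (suc j) k
μF-∷ y ρ φ φ-∷ zero    j = φ-∷ j
μF-∷ y ρ φ φ-∷ (suc k) j rewrite φ-∷ j | μF-∷ y ρ φ φ-∷ k (suc j) = refl

μ-∷ : ∀ φ y (ρ : Trace m) j → μ (y ∷ ρ) φ (suc (suc j)) ≡ μ ρ φ (suc j)
μ-∷ (atom p) y ρ j = refl
μ-∷ (¬' φ)   y ρ j = cong ¬₃ (μ-∷ φ y ρ j)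
μ-∷ (φ ∨' ψ) y ρ j rewrite μ-∷ φ y ρ j | μ-∷ ψ y ρ j = refl
μ-∷ (X' φ)   y ρ j = μ-∷ φ y ρ (suc j)
μ-∷ (φ U' ψ) y ρ j = μU-∷ y ρ φ ψ (μ-∷ φ y ρ) (μ-∷ ψ y ρ) (length ρ ∸ j) j
μ-∷ (F' φ)   y ρ j = μF-∷ y ρ φ (μ-∷ φ y ρ) (length ρ ∸ j) j

μ-drop : ∀ φ t (ρ : Trace m) → μ (drop t ρ) φ 1 ≡ μ ρ φ (suc t)
μ-drop φ zero    ρ       = refl
μ-drop φ (suc t) []      =
  trans (μ-past-end [] φ 1 (s≤s z≤n)) (sym (μ-past-end [] φ (suc (suc t)) (s≤s z≤n)))
μ-drop φ (suc t) (y ∷ ρ) = trans (μ-drop φ t ρ) (sym (μ-∷ φ y ρ t))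

μ-slice : ∀ (π : Trace m) φ j x → μ (infix-slice π (suc j) x) φ 1 ≡ μ-prefix π φ (suc j) x
μ-slice π φ j x = begin
  μ (take (suc x) (drop j π)) φ 1      ≡⟨ cong (λ ρ → μ ρ φ 1) (take-drop (suc x) j π) ⟩
  μ (drop j (take (j + suc x) π)) φ 1  ≡⟨ μ-drop φ j (take (j + suc x) π) ⟩
  μ (take (j + suc x) π) φ (suc j)     ≡⟨ cong (λ t → μ (take t π) φ (suc j)) (+-suc j x) ⟩
  μ (take (suc j + x) π) φ (suc j)     ∎
  where open ≡-Reasoning

lemma3 : ∀ {m} (π : Trace m) (i : ℕ) → 1 ≤ i → (φ : Formula m) →
    (μ π φ i ≡ V⊤ ⇔
      (∃[ a ] (a + i ≤ length π × d π φ i ≡ (fin a , -')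
              × (∀ x → x < a → μ (infix-slice π i x) φ 1 ≢ V⊤))))
    × (μ π φ i ≡ V⊥ ⇔
      (∃[ a ] (a + i ≤ length π × d π φ i ≡ (-' , fin a)
              × (∀ x → x < a → μ (infix-slice π i x) φ 1 ≢ V⊥))))
    × (μ π φ i ≡ V? ⇔
      (∃[ b₁ ] ∃[ b₂ ] (d π φ i ≡ (b₁ , b₂)
        × (b₁ ≡ ∞ ⊎ ∃[ n ] (b₁ ≡ fin n × length π < n + i))
        × (b₂ ≡ ∞ ⊎ ∃[ n ] (b₂ ≡ fin n × length π < n + i)))))
lemma3 π (suc j) 1≤i φ = agree-⊤⇔ A M , agree-⊥⇔ A M , agree-?⇔ A
  where
  A : Agree (length π) (suc j) (μ π φ (suc j)) (d π φ (suc j))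
  A = proj₁ (describes π φ (suc j) 1≤i)
  M : Minimal (λ x → μ (infix-slice π (suc j) x) φ 1) (d π φ (suc j))
  M = minimal-cong (μ-slice π φ j) (proj₂ (describes π φ (suc j) 1≤i))
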